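{- Let $\lambda$ be a partition with $\ell(\lambda)\le n$, with $\lambda_i=0$ for $i>\ell(\lambda)$. For $1\le i\le n$ let $\lambda^{r}_i$ be the partition obtained from $\lambda$ by removing its $i$th row (so $\lambda^{r}_i=\lambda$ if $i>\ell(\lambda)$). Then for every integer $k\ge 0$, \[ \sum_{i=1}^n q^{i-1+\lambda_i}R_k(\lambda^{r}_i)=[n]R_k(\lambda)-[k]R_k(\lambda). \]
   Context: $q$ is an indeterminate and $[x]=(1-q^x)/(1-q)$ for integers $x$. A partition $\lambda$ is identified with its Ferrers board of cells $(i,j)$, $1\le j\le\lambda_i$, rows numbered from the top and columns from the left. The Garsia–Remmel $q$-rook number $R_k(\lambda)=\sum_p q^{\mathrm{inv}(p)}$, summed over placements $p$ of $k$ non-attacking rooks on cells of $\lambda$, where $\mathrm{inv}(p)$ is the number of cells of $\lambda$ that contain no rook, are not to the left of a rook in the same row, and are not above a rook in the same column. -}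

module Defs where

open import Level using (Level)
open import Data.Bool using (Bool; true; false; _∧_; _∨_; not; T)
open import Data.Nat using (ℕ; zero; suc; _∸_; _≡ᵇ_; _<ᵇ_; _≥_; _≤_)
open import Data.Product using (_×_; _,_; proj₁; proj₂)
open import Data.List using (List; []; _∷_; _++_; map; concatMap; filter; length; foldr; upTo)
open import Data.Bool.ListAction using (all; any)
open import Data.List.Relation.Unary.Linked using (Linked)
open import Data.List.Relation.Unary.All using (All)
open import Algebra.Bundles using (CommutativeRing)
open import Relation.Nullary.Decidable using (Dec; yes; no)

IsPartition : List ℕ → Set
IsPartition la = Linked _≥_ la × All (λ x → 1 ≤ x) la

-- λ_i, rows numbered from 1 (returns 0 for i = 0 or i > ℓ(λ)).
part : List ℕ → ℕ → ℕ
part []       _             = 0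
part (x ∷ xs) zero          = 0
part (x ∷ xs) (suc zero)    = x
part (x ∷ xs) (suc (suc i)) = part xs (suc i)

removeRow : List ℕ → ℕ → List ℕ
removeRow []       _             = []
removeRow (x ∷ xs) zero          = x ∷ xs
removeRow (x ∷ xs) (suc zero)    = xs
removeRow (x ∷ xs) (suc (suc i)) = x ∷ removeRow xs (suc i)

Cell : Set
Cell = ℕ × ℕ   -- (row i, column j), both 1-indexed, rows from the top

cellsFrom : ℕ → List ℕ → List Cell
cellsFrom i []       = []
cellsFrom i (x ∷ xs) = map (λ j → (i , suc j)) (upTo x) ++ cellsFrom (suc i) xs

cells : List ℕ → List Cell
cells = cellsFrom 1

sublists : {A : Set} → List A → List (List A)
sublists []       = [] ∷ []
sublists (x ∷ xs) = map (x ∷_) (sublists xs) ++ sublists xs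

sameCell : Cell → Cell → Bool
sameCell (i , j) (i' , j') = (i ≡ᵇ i') ∧ (j ≡ᵇ j')

nonAttacking : List Cell → Bool
nonAttacking []       = true
nonAttacking (c ∷ cs) =
  all (λ d → not (proj₁ c ≡ᵇ proj₁ d) ∧ not (proj₂ c ≡ᵇ proj₂ d)) cs ∧ nonAttacking cs

placements : ℕ → List ℕ → List (List Cell)
placements k la = filter (λ p → T? (nonAttacking p ∧ (length p ≡ᵇ k))) (sublists (cells la))
  where
  T? : (b : Bool) → Dec (T b)
  T? true  = yes _
  T? false = no (λ ())

countedCell : List Cell → Cell → Bool
countedCell p c =
  not (any (sameCell c) p)
  ∧ not (any (λ r → (proj₁ r ≡ᵇ proj₁ c) ∧ (proj₂ c <ᵇ proj₂ r)) p)
  ∧ not (any (λ r → (proj₂ r ≡ᵇ proj₂ c) ∧ (proj₁ c <ᵇ proj₁ r)) p)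

inv : List ℕ → List Cell → ℕ
inv la p = length (Data.List.filter (λ c → T? (countedCell p c)) (cells la))
  where
  T? : (b : Bool) → Dec (T b)
  T? true  = yes _
  T? false = no (λ ())

-- Everything polynomial in q is evaluated in an arbitrary commutative ring at an
-- arbitrary element q (equivalent to an identity in ℤ[q]).
module QRook {c ℓ : Level} (R : CommutativeRing c ℓ) where
  open CommutativeRing R

  pow : Carrier → ℕ → Carrier
  pow q zero    = 1#
  pow q (suc m) = q * pow q m

  sumFrom1 : ℕ → (ℕ → Carrier) → Carrier
  sumFrom1 zero    f = 0#
  sumFrom1 (suc n) f = sumFrom1 n f + f (suc n)

  qint : Carrier → ℕ → Carrier
  qint q x = sumFrom1 x (λ i → pow q (i ∸ 1))

  qRook : Carrier → ℕ → List ℕ → Carrier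
  qRook q k la = foldr _+_ 0# (map (λ p → pow q (inv la p)) (placements k la))

module Submission where

-- Split off the top row of λ = x ∷ μ (its longest row).  Every cell of the top row lies
-- above all of μ, so when the k rooks all lie in μ the counted top-row cells are those in the x - k
-- columns free of rooks; a rook in the top row instead sees the free columns to its right, and
-- summing over its x - k + 1 possible columns gives a q-integer.  This is the Garsia–Remmel recurrence
--     R_k(x ∷ μ) = q^{x-k} R_k(μ) + [x-k+1] R_{k-1}(μ).
-- Removing row i ≥ 2 of x ∷ μ keeps the top row, so the recurrence applies to every term of the
-- left-hand side but the first, and induction on λ using [n+1] = 1 + q[n] closes the identity.

open import Defs
open import Level using (Level)
open import Data.Nat using (ℕ; zero; suc; _∸_; _≤_; _<_; _≥_; _≡ᵇ_; _<ᵇ_; z≤n; s≤s; _≤?_)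
import Data.Nat as N
open import Data.Nat.Properties
  using ( ≡ᵇ⇒≡; ≡⇒≡ᵇ; <ᵇ⇒<; <⇒<ᵇ; <⇒≢; <⇒≯; <⇒≱; ≰⇒>; <-irrefl; ≤-trans; m≤n⇒m≤1+n
        ; +-suc; m+n∸m≡n; m∸n+n≡m)
  renaming (+-identityʳ to ℕ-+-identityʳ)
open import Data.Bool using (Bool; true; false; _∧_; _∨_; not; T; if_then_else_)
open import Data.Bool.Properties
  using (∧-zeroʳ; ∧-identityʳ; ∨-identityʳ; ∧-assoc; ∧-conicalˡ; ∧-conicalʳ; not-injective)
open import Data.Bool.ListAction using (all; any)
open import Data.Product using (_×_; _,_; proj₁; proj₂)
open import Data.List using (List; []; _∷_; _++_; length; map; filter; foldr; upTo; applyUpTo)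
open import Data.List.Properties using (map-++; map-∘; length-map)
open import Data.List.Relation.Unary.All as All using (All; []; _∷_)
import Data.List.Relation.Unary.All.Properties as All
open import Data.List.Relation.Unary.AllPairs using (AllPairs; []; _∷_)
open import Data.List.Relation.Unary.Linked.Properties using (Linked⇒AllPairs)
open import Data.Unit using (tt)
open import Data.Empty using (⊥-elim)
open import Function using (_∘_; id; flip)
open import Relation.Nullary using (Dec; yes; no; ¬_)
open import Relation.Binary.PropositionalEquality using (_≡_; refl; sym; trans; cong; cong₂; subst)
open import Algebra.Bundles using (CommutativeRing)
import Algebra.Properties.CommutativeSemigroup as CommutativeSemigroupProperties
import Algebra.Properties.Group as GroupProperties
import Algebra.Solver.Ring.NaturalCoefficients.Default as NaturalCoefficientsSolver
import Relation.Binary.Reasoning.Setoid as SetoidReasoning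

T⇒≡true : ∀ {b} → T b → b ≡ true
T⇒≡true {true} _ = refl

¬T⇒≡false : ∀ {b} → ¬ T b → b ≡ false
¬T⇒≡false {false} _  = refl
¬T⇒≡false {true}  ¬t = ⊥-elim (¬t tt)

≡ᵇ-refl : ∀ n → (n ≡ᵇ n) ≡ true
≡ᵇ-refl n = T⇒≡true (≡⇒≡ᵇ n n refl)

≡ᵇ-sym : ∀ m n → (m ≡ᵇ n) ≡ (n ≡ᵇ m)
≡ᵇ-sym zero    zero    = refl
≡ᵇ-sym zero    (suc n) = refl
≡ᵇ-sym (suc m) zero    = refl
≡ᵇ-sym (suc m) (suc n) = ≡ᵇ-sym m n

≡ᵇ-true⇒≡ : ∀ {m n} → (m ≡ᵇ n) ≡ true → m ≡ n
≡ᵇ-true⇒≡ {m} {n} e = ≡ᵇ⇒≡ m n (subst T (sym e) tt)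

<⇒≡ᵇ-false : ∀ {m n} → m < n → (m ≡ᵇ n) ≡ false
<⇒≡ᵇ-false {m} {n} m<n = ¬T⇒≡false (<⇒≢ m<n ∘ ≡ᵇ⇒≡ m n)

>⇒≡ᵇ-false : ∀ {m n} → m < n → (n ≡ᵇ m) ≡ false
>⇒≡ᵇ-false {m} {n} m<n = trans (≡ᵇ-sym n m) (<⇒≡ᵇ-false m<n)

<ᵇ-irrefl : ∀ n → (n <ᵇ n) ≡ false
<ᵇ-irrefl n = ¬T⇒≡false (<-irrefl refl ∘ <ᵇ⇒< n n)

<⇒<ᵇ-true : ∀ {m n} → m < n → (m <ᵇ n) ≡ true
<⇒<ᵇ-true = T⇒≡true ∘ <⇒<ᵇ

<⇒>ᵇ-false : ∀ {m n} → m < n → (n <ᵇ m) ≡ false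
<⇒>ᵇ-false {m} {n} m<n = ¬T⇒≡false (<⇒≯ m<n ∘ <ᵇ⇒< n m)

≢ᵇ∧≮ᵇ⇒>ᵇ : ∀ m n b → (not (m ≡ᵇ n) ∧ (not (m <ᵇ n) ∧ b)) ≡ ((n <ᵇ m) ∧ b)
≢ᵇ∧≮ᵇ⇒>ᵇ zero    zero    b = refl
≢ᵇ∧≮ᵇ⇒>ᵇ zero    (suc n) b = refl
≢ᵇ∧≮ᵇ⇒>ᵇ (suc m) zero    b = refl
≢ᵇ∧≮ᵇ⇒>ᵇ (suc m) (suc n) b = ≢ᵇ∧≮ᵇ⇒>ᵇ m n b

any-false : ∀ {A : Set} {P : A → Set} (f : A → Bool) {xs} → All P xs →
            (∀ {x} → P x → f x ≡ false) → any f xs ≡ false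
any-false f []         h = refl
any-false f (px ∷ pxs) h rewrite h px = any-false f pxs h

any-cong : ∀ {A : Set} {P : A → Set} (f g : A → Bool) {xs} → All P xs →
           (∀ {x} → P x → f x ≡ g x) → any f xs ≡ any g xs
any-cong f g []         h = refl
any-cong f g (px ∷ pxs) h = cong₂ _∨_ (h px) (any-cong f g pxs h)

any-map : ∀ {A B : Set} (f : B → Bool) (g : A → B) xs → any f (map g xs) ≡ any (f ∘ g) xs
any-map f g []       = refl
any-map f g (x ∷ xs) = cong (f (g x) ∨_) (any-map f g xs)

all-map : ∀ {A B : Set} (f : B → Bool) (g : A → B) xs → all f (map g xs) ≡ all (f ∘ g) xs
all-map f g []       = refl
all-map f g (x ∷ xs) = cong (f (g x) ∧_) (all-map f g xs)

count : ∀ {A : Set} → (A → Bool) → List A → ℕ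
count b []       = 0
count b (x ∷ xs) = if b x then suc (count b xs) else count b xs

count-++ : ∀ {A : Set} (b : A → Bool) xs ys → count b (xs ++ ys) ≡ count b xs N.+ count b ys
count-++ b []       ys = refl
count-++ b (x ∷ xs) ys with b x
... | true  = cong suc (count-++ b xs ys)
... | false = count-++ b xs ys

count-map : ∀ {A B : Set} (b : B → Bool) (g : A → B) xs → count b (map g xs) ≡ count (b ∘ g) xs
count-map b g []       = refl
count-map b g (x ∷ xs) with b (g x)
... | true  = cong suc (count-map b g xs)
... | false = count-map b g xs

count-cong : ∀ {A : Set} {b c : A → Bool} xs → (∀ x → b x ≡ c x) → count b xs ≡ count c xs
count-cong             []       h = refl
count-cong {b = b} {c} (x ∷ xs) h rewrite h x | count-cong {b = b} {c} xs h = refl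

count-cong-All : ∀ {A : Set} {P : A → Set} (b c : A → Bool) {xs} → All P xs →
                 (∀ {x} → P x → b x ≡ c x) → count b xs ≡ count c xs
count-cong-All b c []         h = refl
count-cong-All b c (px ∷ pxs) h rewrite h px | count-cong-All b c pxs h = refl

length-filter≡count : ∀ {A : Set} (b : A → Bool) (b? : ∀ x → Dec (T (b x))) xs →
                      length (filter b? xs) ≡ count b xs
length-filter≡count b b? []       = refl
length-filter≡count b b? (x ∷ xs) with b x | b? x
... | true  | yes _  = cong suc (length-filter≡count b b? xs)
... | true  | no ¬t  = ⊥-elim (¬t tt)
... | false | no _   = length-filter≡count b b? xs

countUpTo : (ℕ → Bool) → ℕ → ℕ
countUpTo f zero    = 0
countUpTo f (suc n) = if f 0 then suc (countUpTo (f ∘ suc) n) else countUpTo (f ∘ suc) n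

count-applyUpTo : ∀ {A : Set} (b : A → Bool) (g : ℕ → A) n → count b (applyUpTo g n) ≡ countUpTo (b ∘ g) n
count-applyUpTo b g zero    = refl
count-applyUpTo b g (suc n) with b (g 0)
... | true  = cong suc (count-applyUpTo b (g ∘ suc) n)
... | false = count-applyUpTo b (g ∘ suc) n

countUpTo-cong : ∀ {f g} n → (∀ j → f j ≡ g j) → countUpTo f n ≡ countUpTo g n
countUpTo-cong         zero    h = refl
countUpTo-cong {f} {g} (suc n) h rewrite h 0 | countUpTo-cong {f ∘ suc} {g ∘ suc} n (h ∘ suc) = refl

countUpTo-≤ : ∀ f n → countUpTo f n ≤ n
countUpTo-≤ f zero    = z≤n
countUpTo-≤ f (suc n) with f 0
... | true  = s≤s (countUpTo-≤ (f ∘ suc) n)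
... | false = m≤n⇒m≤1+n (countUpTo-≤ (f ∘ suc) n)

countUpTo-+-not : ∀ f n → countUpTo f n N.+ countUpTo (not ∘ f) n ≡ n
countUpTo-+-not f zero    = refl
countUpTo-+-not f (suc n) with f 0
... | true  = cong suc (countUpTo-+-not (f ∘ suc) n)
... | false = trans (+-suc _ _) (cong suc (countUpTo-+-not (f ∘ suc) n))

countUpTo-not : ∀ f n → countUpTo (not ∘ f) n ≡ n ∸ countUpTo f n
countUpTo-not f n = trans (sym (m+n∸m≡n (countUpTo f n) _)) (cong (_∸ countUpTo f n) (countUpTo-+-not f n))

countUpTo-∨ : ∀ f g n → (∀ j → f j ≡ true → g j ≡ false) →
              countUpTo (λ j → f j ∨ g j) n ≡ countUpTo f n N.+ countUpTo g n
countUpTo-∨ f g zero    h = refl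
countUpTo-∨ f g (suc n) h with f 0 in e
... | true rewrite h 0 e = cong suc (countUpTo-∨ (f ∘ suc) (g ∘ suc) n (h ∘ suc))
... | false with g 0
...   | true  = trans (cong suc (countUpTo-∨ (f ∘ suc) (g ∘ suc) n (h ∘ suc))) (sym (+-suc _ _))
...   | false = countUpTo-∨ (f ∘ suc) (g ∘ suc) n (h ∘ suc)

countUpTo-false : ∀ n → countUpTo (λ _ → false) n ≡ 0
countUpTo-false zero    = refl
countUpTo-false (suc n) = countUpTo-false n

countUpTo-≡ᵇ : ∀ {a n} → 1 ≤ a → a ≤ n → countUpTo (λ j → a ≡ᵇ suc j) n ≡ 1
countUpTo-≡ᵇ {suc zero}    {suc n} _ _         = cong suc (countUpTo-false n)
countUpTo-≡ᵇ {suc (suc a)} {suc n} _ (s≤s a<n) = countUpTo-≡ᵇ (s≤s z≤n) a<n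

-- Boards and rook placements

below : Cell → Cell
below (r , c) = (suc r , c)

rowCells : ℕ → ℕ → List Cell
rowCells i x = map (λ j → (i , suc j)) (upTo x)

cellsFrom-suc : ∀ i la → cellsFrom (suc i) la ≡ map below (cellsFrom i la)
cellsFrom-suc i []       = refl
cellsFrom-suc i (x ∷ xs) =
  trans (cong₂ _++_ (map-∘ (upTo x)) (cellsFrom-suc (suc i) xs))
        (sym (map-++ below (rowCells i x) (cellsFrom (suc i) xs)))

sublists-map : ∀ {A B : Set} (f : A → B) xs → sublists (map f xs) ≡ map (map f) (sublists xs)
sublists-map f []       = refl
sublists-map f (x ∷ xs) rewrite sublists-map f xs =
  trans (cong (_++ map (map f) (sublists xs)) (trans (sym (map-∘ (sublists xs))) (map-∘ (sublists xs))))
        (sym (map-++ (map f) (map (x ∷_) (sublists xs)) (sublists xs)))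

sublists-All : ∀ {A : Set} {P : A → Set} {xs} → All P xs → All (All P) (sublists xs)
sublists-All []         = [] ∷ []
sublists-All (px ∷ pxs) = All.++⁺ (All.map⁺ (All.map (px ∷_) (sublists-All pxs))) (sublists-All pxs)

InColumns : ℕ → Cell → Set
InColumns x (_ , c) = 1 ≤ c × c ≤ x

BelowRow : ℕ → ℕ → Cell → Set
BelowRow i x cell = i < proj₁ cell × InColumns x cell

All-rowCells : ∀ i x → All (λ cell → proj₁ cell ≡ i) (rowCells i x)
All-rowCells i x = All.map⁺ (All.applyUpTo⁺₂ id x (λ _ → refl))

All-BelowRow-cellsFrom : ∀ {i x} i′ {μ} → All (_≤ x) μ → i < i′ → All (BelowRow i x) (cellsFrom i′ μ)
All-BelowRow-cellsFrom i′ []           _ = []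
All-BelowRow-cellsFrom i′ (y≤x ∷ μ≤x) i<i′ =
  All.++⁺ (All.map⁺ (All.applyUpTo⁺₁ id _ (λ j<y → i<i′ , s≤s z≤n , ≤-trans j<y y≤x)))
          (All-BelowRow-cellsFrom (suc i′) μ≤x (m≤n⇒m≤1+n i<i′))

All-removeRow : ∀ {P : ℕ → Set} {μ} → All P μ → ∀ j → All P (removeRow μ j)
All-removeRow []         _             = []
All-removeRow (px ∷ pxs) zero          = px ∷ pxs
All-removeRow (px ∷ pxs) (suc zero)    = pxs
All-removeRow (px ∷ pxs) (suc (suc j)) = px ∷ All-removeRow pxs (suc j)

hasColumn : ℕ → List Cell → Bool
hasColumn c t = any (λ r → proj₂ r ≡ᵇ c) t

nonAttacking-below : ∀ p → nonAttacking (map below p) ≡ nonAttacking p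
nonAttacking-below []               = refl
nonAttacking-below ((r , c) ∷ cs)
  rewrite all-map (λ d → not (suc r ≡ᵇ proj₁ d) ∧ not (c ≡ᵇ proj₂ d)) below cs | nonAttacking-below cs = refl

countedCell-below : ∀ p c → countedCell (map below p) (below c) ≡ countedCell p c
countedCell-below p (r , c) rewrite any-map (sameCell (suc r , c)) below p
  | any-map (λ s → (proj₁ s ≡ᵇ suc r) ∧ (c <ᵇ proj₂ s)) below p
  | any-map (λ s → (proj₂ s ≡ᵇ c) ∧ (suc r <ᵇ proj₁ s)) below p = refl

nonAttacking-sameRow : ∀ i a b s → nonAttacking ((i , a) ∷ (i , b) ∷ s) ≡ false
nonAttacking-sameRow i a b s rewrite ≡ᵇ-refl i = refl

head-column-free : ∀ r t →
                   all (λ d → not (proj₁ r ≡ᵇ proj₁ d) ∧ not (proj₂ r ≡ᵇ proj₂ d)) t ≡ true →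
                   hasColumn (proj₂ r) t ≡ false
head-column-free r []      _ = refl
head-column-free r (d ∷ t) e =
  cong₂ _∨_ (trans (≡ᵇ-sym (proj₂ d) (proj₂ r)) (not-injective (∧-conicalʳ otherRow otherColumn apart)))
            (head-column-free r t (∧-conicalʳ (otherRow ∧ otherColumn) _ e))
  where
  otherRow otherColumn : Bool
  otherRow    = not (proj₁ r ≡ᵇ proj₁ d)
  otherColumn = not (proj₂ r ≡ᵇ proj₂ d)
  apart : (otherRow ∧ otherColumn) ≡ true
  apart = ∧-conicalˡ (otherRow ∧ otherColumn) _ e

countUpTo-hasColumn : ∀ {x} t → nonAttacking t ≡ true → All (InColumns x) t →
                      countUpTo (λ j → hasColumn (suc j) t) x ≡ length t
countUpTo-hasColumn {x} []      _  []             = countUpTo-false x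
countUpTo-hasColumn {x} (r ∷ t) na ((1≤c , c≤x) ∷ t-in) =
  trans (countUpTo-∨ (λ j → proj₂ r ≡ᵇ suc j) (λ j → hasColumn (suc j) t) x disjoint)
        (cong₂ N._+_ (countUpTo-≡ᵇ 1≤c c≤x) (countUpTo-hasColumn t (∧-conicalʳ headFree _ na) t-in))
  where
  headFree : Bool
  headFree = all (λ d → not (proj₁ r ≡ᵇ proj₁ d) ∧ not (proj₂ r ≡ᵇ proj₂ d)) t
  disjoint : ∀ j → (proj₂ r ≡ᵇ suc j) ≡ true → hasColumn (suc j) t ≡ false
  disjoint j e = subst (λ c → hasColumn c t ≡ false) (≡ᵇ-true⇒≡ e)
                       (head-column-free r t (∧-conicalˡ headFree _ na))

countedCell-belowRow : ∀ {i x} t j₀ {c} → BelowRow i x c → countedCell ((i , j₀) ∷ t) c ≡ countedCell t c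
countedCell-belowRow t j₀ {r , col} (i<r , _)
  rewrite <⇒≡ᵇ-false i<r | >⇒≡ᵇ-false i<r | <⇒>ᵇ-false i<r | ∧-zeroʳ (j₀ ≡ᵇ col) = refl

module _ {i x : ℕ} {t : List Cell} (t-below : All (BelowRow i x) t) where

  private
    noRookAt : ∀ c → any (sameCell (i , c)) t ≡ false
    noRookAt c = any-false _ t-below (λ {r} p → cong (_∧ (c ≡ᵇ proj₂ r)) (<⇒≡ᵇ-false (proj₁ p)))

    noRookRightOf : ∀ c → any (λ r → (proj₁ r ≡ᵇ i) ∧ (c <ᵇ proj₂ r)) t ≡ false
    noRookRightOf c = any-false _ t-below (λ {r} p → cong (_∧ (c <ᵇ proj₂ r)) (>⇒≡ᵇ-false (proj₁ p)))

    rookBelow≡hasColumn : ∀ c → any (λ r → (proj₂ r ≡ᵇ c) ∧ (i <ᵇ proj₁ r)) t ≡ hasColumn c t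
    rookBelow≡hasColumn c =
      any-cong _ _ t-below λ {r} p →
        trans (cong ((proj₂ r ≡ᵇ c) ∧_) (<⇒<ᵇ-true (proj₁ p))) (∧-identityʳ _)

  countedCell-inRow : ∀ c → countedCell t (i , c) ≡ not (hasColumn c t)
  countedCell-inRow c rewrite noRookAt c | noRookRightOf c | rookBelow≡hasColumn c = refl

  countedCell-inRow-rook : ∀ j₀ j →
    countedCell ((i , suc j₀) ∷ t) (i , suc j) ≡ (j₀ <ᵇ j) ∧ not (hasColumn (suc j) t)
  countedCell-inRow-rook j₀ j
    rewrite noRookAt (suc j) | noRookRightOf (suc j) | rookBelow≡hasColumn (suc j)
          | ≡ᵇ-refl i | <ᵇ-irrefl i | ∧-zeroʳ (j₀ ≡ᵇ j) | ∨-identityʳ (j ≡ᵇ j₀) | ∨-identityʳ (j <ᵇ j₀)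
          = ≢ᵇ∧≮ᵇ⇒>ᵇ j j₀ _

  nonAttacking-rowRook : ∀ j → nonAttacking ((i , j) ∷ t) ≡ not (hasColumn j t) ∧ nonAttacking t
  nonAttacking-rowRook j = cong (_∧ nonAttacking t) (apart≡free t-below)
    where
    apart≡free : ∀ {s} → All (BelowRow i x) s →
                 all (λ d → not (i ≡ᵇ proj₁ d) ∧ not (j ≡ᵇ proj₂ d)) s ≡ not (hasColumn j s)
    apart≡free []                   = refl
    apart≡free {d ∷ s} (d-below ∷ s-below)
      rewrite <⇒≡ᵇ-false (proj₁ d-below) | ≡ᵇ-sym j (proj₂ d) | apart≡free s-below with proj₂ d ≡ᵇ j
    ... | true  = refl
    ... | false = refl

isPlacement : ℕ → List Cell → Bool
isPlacement k p = nonAttacking p ∧ (length p ≡ᵇ k)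

isPlacement⇒ : ∀ k t → isPlacement k t ≡ true → nonAttacking t ≡ true × length t ≡ k
isPlacement⇒ k t e = ∧-conicalˡ (nonAttacking t) (length t ≡ᵇ k) e
                   , ≡ᵇ-true⇒≡ (∧-conicalʳ (nonAttacking t) (length t ≡ᵇ k) e)

-- Sums in a commutative ring

module RookSums {c ℓ : Level} (R : CommutativeRing c ℓ) (q : CommutativeRing.Carrier R) where

  open CommutativeRing R renaming (refl to ≈-refl; sym to ≈-sym; trans to ≈-trans; reflexive to ≈-reflexive)
  open QRook R
  open SetoidReasoning setoid
  open CommutativeSemigroupProperties +-commutativeSemigroup using (interchange; x∙yz≈y∙xz)
  open CommutativeSemigroupProperties *-commutativeSemigroup using () renaming (x∙yz≈y∙xz to x*yz≈y*xz)
  open NaturalCoefficientsSolver commutativeSemiring using (solve; _:+_; _:*_; _:=_; con)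

  ∑ : ∀ {A : Set} → List A → (A → Carrier) → Carrier
  ∑ []       f = 0#
  ∑ (a ∷ as) f = f a + ∑ as f

  ∑-++ : ∀ {A : Set} (xs ys : List A) f → ∑ (xs ++ ys) f ≈ ∑ xs f + ∑ ys f
  ∑-++ []       ys f = ≈-sym (+-identityˡ _)
  ∑-++ (x ∷ xs) ys f = ≈-trans (+-congˡ (∑-++ xs ys f)) (≈-sym (+-assoc _ _ _))

  ∑-map : ∀ {A B : Set} (g : A → B) xs f → ∑ (map g xs) f ≡ ∑ xs (f ∘ g)
  ∑-map g []       f = refl
  ∑-map g (x ∷ xs) f = cong (f (g x) +_) (∑-map g xs f)

  ∑-cong-All : ∀ {A : Set} {P : A → Set} {xs f g} → All P xs → (∀ {a} → P a → f a ≈ g a) →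
               ∑ xs f ≈ ∑ xs g
  ∑-cong-All []         h = ≈-refl
  ∑-cong-All (px ∷ pxs) h = +-cong (h px) (∑-cong-All pxs h)

  ∑-cong : ∀ {A : Set} (xs : List A) {f g} → (∀ a → f a ≈ g a) → ∑ xs f ≈ ∑ xs g
  ∑-cong xs h = ∑-cong-All (All.universal (λ _ → tt) xs) (λ {a} _ → h a)

  ∑-zero : ∀ {A : Set} (xs : List A) {f} → (∀ a → f a ≈ 0#) → ∑ xs f ≈ 0#
  ∑-zero []       h = ≈-refl
  ∑-zero (x ∷ xs) h = ≈-trans (+-cong (h x) (∑-zero xs h)) (+-identityˡ 0#)

  ∑-*ˡ : ∀ {A : Set} (xs : List A) a f → ∑ xs (λ x → a * f x) ≈ a * ∑ xs f
  ∑-*ˡ []       a f = ≈-sym (zeroʳ a)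
  ∑-*ˡ (x ∷ xs) a f = ≈-trans (+-congˡ (∑-*ˡ xs a f)) (≈-sym (distribˡ a _ _))

  ∑-+ : ∀ {A : Set} (xs : List A) f g → ∑ xs (λ x → f x + g x) ≈ ∑ xs f + ∑ xs g
  ∑-+ []       f g = ≈-sym (+-identityˡ 0#)
  ∑-+ (x ∷ xs) f g = ≈-trans (+-congˡ (∑-+ xs f g)) (interchange _ _ _ _)

  ∑-comm : ∀ {A B : Set} (xs : List A) (ys : List B) (f : A → B → Carrier) →
           ∑ xs (λ x → ∑ ys (f x)) ≈ ∑ ys (λ y → ∑ xs (λ x → f x y))
  ∑-comm []       ys f = ≈-sym (∑-zero ys {λ _ → 0#} (λ _ → ≈-refl))
  ∑-comm (x ∷ xs) ys f =
    ≈-trans (+-congˡ (∑-comm xs ys f)) (≈-sym (∑-+ ys (f x) (λ y → ∑ xs (λ x′ → f x′ y))))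

  ∑-filter : ∀ {A : Set} (b : A → Bool) (b? : ∀ x → Dec (T (b x))) xs g →
             foldr _+_ 0# (map g (filter b? xs)) ≈ ∑ xs (λ x → if b x then g x else 0#)
  ∑-filter b b? []       g = ≈-refl
  ∑-filter b b? (x ∷ xs) g with b x | b? x
  ... | true  | yes _ = +-congˡ (∑-filter b b? xs g)
  ... | true  | no ¬t = ⊥-elim (¬t tt)
  ... | false | no _  = ≈-trans (∑-filter b b? xs g) (≈-sym (+-identityˡ _))

  ∑-sublists-∷ : ∀ {A : Set} x (xs : List A) f →
                 ∑ (sublists (x ∷ xs)) f ≈ ∑ (sublists xs) (f ∘ (x ∷_)) + ∑ (sublists xs) f
  ∑-sublists-∷ x xs f = ≈-trans (∑-++ (map (x ∷_) (sublists xs)) (sublists xs) f)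
                                (+-congʳ (≈-reflexive (∑-map (x ∷_) (sublists xs) f)))

  ∑-sublists-++ : ∀ {A : Set} (xs ys : List A) f →
                  ∑ (sublists (xs ++ ys)) f ≈ ∑ (sublists xs) (λ s → ∑ (sublists ys) (λ t → f (s ++ t)))
  ∑-sublists-++ []       ys f = ≈-sym (+-identityʳ _)
  ∑-sublists-++ (x ∷ xs) ys f = begin
    ∑ (sublists (x ∷ xs ++ ys)) f
      ≈⟨ ∑-sublists-∷ x (xs ++ ys) f ⟩
    ∑ (sublists (xs ++ ys)) (f ∘ (x ∷_)) + ∑ (sublists (xs ++ ys)) f
      ≈⟨ +-cong (∑-sublists-++ xs ys (f ∘ (x ∷_))) (∑-sublists-++ xs ys f) ⟩
    ∑ (sublists xs) (extend ∘ (x ∷_)) + ∑ (sublists xs) extend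
      ≈⟨ ∑-sublists-∷ x xs extend ⟨
    ∑ (sublists (x ∷ xs)) extend ∎
    where
    extend : _ → Carrier
    extend s = ∑ (sublists ys) (λ t → f (s ++ t))

  ∑-sublists-onlyEmpty : ∀ {A : Set} {P : A → Set} {xs} → All P xs → ∀ g →
                         (∀ {a} s → P a → g (a ∷ s) ≈ 0#) → ∑ (sublists xs) g ≈ g []
  ∑-sublists-onlyEmpty []               g h = +-identityʳ _
  ∑-sublists-onlyEmpty {xs = x ∷ xs} (px ∷ pxs) g h = begin
    ∑ (sublists (x ∷ xs)) g
      ≈⟨ ∑-sublists-∷ x xs g ⟩
    ∑ (sublists xs) (g ∘ (x ∷_)) + ∑ (sublists xs) g
      ≈⟨ +-cong (∑-zero (sublists xs) (λ s → h s px)) (∑-sublists-onlyEmpty pxs g h) ⟩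
    0# + g []
      ≈⟨ +-identityˡ _ ⟩
    g [] ∎

  ∑-sublists-atMostOne : ∀ {A : Set} {P : A → Set} {xs} → All P xs → ∀ g →
                         (∀ {a b} s → P a → P b → g (a ∷ b ∷ s) ≈ 0#) →
                         ∑ (sublists xs) g ≈ g [] + ∑ xs (λ a → g (a ∷ []))
  ∑-sublists-atMostOne []               g h = ≈-refl
  ∑-sublists-atMostOne {xs = x ∷ xs} (px ∷ pxs) g h = begin
    ∑ (sublists (x ∷ xs)) g
      ≈⟨ ∑-sublists-∷ x xs g ⟩
    ∑ (sublists xs) (g ∘ (x ∷_)) + ∑ (sublists xs) g
      ≈⟨ +-cong (∑-sublists-onlyEmpty pxs (g ∘ (x ∷_)) (λ s pb → h s px pb))
                (∑-sublists-atMostOne pxs g h) ⟩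
    g (x ∷ []) + (g [] + ∑ xs (λ a → g (a ∷ [])))
      ≈⟨ x∙yz≈y∙xz _ _ _ ⟩
    g [] + (g (x ∷ []) + ∑ xs (λ a → g (a ∷ []))) ∎

  sumUpTo : (ℕ → Carrier) → ℕ → Carrier
  sumUpTo F zero    = 0#
  sumUpTo F (suc n) = F 0 + sumUpTo (F ∘ suc) n

  ∑-applyUpTo : ∀ {A : Set} (g : ℕ → A) n f → ∑ (applyUpTo g n) f ≡ sumUpTo (f ∘ g) n
  ∑-applyUpTo g zero    f = refl
  ∑-applyUpTo g (suc n) f = cong (f (g 0) +_) (∑-applyUpTo (g ∘ suc) n f)

  sumUpTo-cong : ∀ {F G} n → (∀ j → F j ≈ G j) → sumUpTo F n ≈ sumUpTo G n
  sumUpTo-cong zero    h = ≈-refl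
  sumUpTo-cong (suc n) h = +-cong (h 0) (sumUpTo-cong n (h ∘ suc))

  sumUpTo-*ʳ : ∀ F a n → sumUpTo (λ j → F j * a) n ≈ sumUpTo F n * a
  sumUpTo-*ʳ F a zero    = ≈-sym (zeroˡ a)
  sumUpTo-*ʳ F a (suc n) = ≈-trans (+-congˡ (sumUpTo-*ʳ (F ∘ suc) a n)) (≈-sym (distribʳ a _ _))

  sumFrom1-shift : ∀ n f → sumFrom1 (suc n) f ≈ f 1 + sumFrom1 n (f ∘ suc)
  sumFrom1-shift zero    f = +-comm _ _
  sumFrom1-shift (suc n) f = ≈-trans (+-congʳ (sumFrom1-shift n f)) (+-assoc _ _ _)

  sumFrom1-cong : ∀ n {f g} → (∀ m → f (suc m) ≈ g (suc m)) → sumFrom1 n f ≈ sumFrom1 n g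
  sumFrom1-cong zero    h = ≈-refl
  sumFrom1-cong (suc n) h = +-cong (sumFrom1-cong n h) (h n)

  sumFrom1-+ : ∀ n f g → sumFrom1 n (λ j → f j + g j) ≈ sumFrom1 n f + sumFrom1 n g
  sumFrom1-+ zero    f g = ≈-sym (+-identityˡ 0#)
  sumFrom1-+ (suc n) f g = ≈-trans (+-congʳ (sumFrom1-+ n f g)) (interchange _ _ _ _)

  sumFrom1-*ˡ : ∀ n a f → sumFrom1 n (λ j → a * f j) ≈ a * sumFrom1 n f
  sumFrom1-*ˡ zero    a f = ≈-sym (zeroʳ a)
  sumFrom1-*ˡ (suc n) a f = ≈-trans (+-congʳ (sumFrom1-*ˡ n a f)) (≈-sym (distribˡ a _ _))

  sumFrom1-*ʳ : ∀ n a f → sumFrom1 n (λ j → f j * a) ≈ sumFrom1 n f * a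
  sumFrom1-*ʳ zero    a f = ≈-sym (zeroˡ a)
  sumFrom1-*ʳ (suc n) a f = ≈-trans (+-congʳ (sumFrom1-*ʳ n a f)) (≈-sym (distribʳ a _ _))

  pow-+ : ∀ m n → pow q (m N.+ n) ≈ pow q m * pow q n
  pow-+ zero    n = ≈-sym (*-identityˡ _)
  pow-+ (suc m) n = ≈-trans (*-congˡ (pow-+ m n)) (≈-sym (*-assoc _ _ _))

  qint-suc : ∀ n → qint q (suc n) ≈ 1# + q * qint q n
  qint-suc n = ≈-trans (sumFrom1-shift n (λ i → pow q (i ∸ 1)))
                       (+-congˡ (≈-trans (sumFrom1-cong n (λ _ → ≈-refl))
                                         (sumFrom1-*ˡ n q (λ i → pow q (i ∸ 1)))))

  -- Read from the right, the free columns receive the exponents 0, 1, 2, …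
  sumUpTo-pow-countAbove : ∀ f n →
    sumUpTo (λ j → if f j then pow q (countUpTo (λ j′ → (j <ᵇ j′) ∧ f j′) n) else 0#) n
      ≈ qint q (countUpTo f n)
  sumUpTo-pow-countAbove f zero    = ≈-refl
  sumUpTo-pow-countAbove f (suc n) with f 0
  ... | true  = ≈-trans (+-congˡ (sumUpTo-pow-countAbove (f ∘ suc) n)) (+-comm _ _)
  ... | false = ≈-trans (+-identityˡ _) (sumUpTo-pow-countAbove (f ∘ suc) n)

  weight : ℕ → List Cell → List Cell → Carrier
  weight k B p = if isPlacement k p then pow q (count (countedCell p) B) else 0#

  qRookBoard : ℕ → List Cell → Carrier
  qRookBoard k B = ∑ (sublists B) (weight k B)

  qRook≈qRookBoard : ∀ k la → qRook q k la ≈ qRookBoard k (cells la)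
  qRook≈qRookBoard k la =
    ≈-trans (∑-filter (isPlacement k) _ (sublists (cells la)) (λ p → pow q (inv la p)))
            (∑-cong (sublists (cells la)) λ p →
              ≈-reflexive (cong (λ n → if isPlacement k p then pow q n else 0#)
                                (length-filter≡count (countedCell p) _ (cells la))))

  weight-below : ∀ k B p → weight k (map below B) (map below p) ≡ weight k B p
  weight-below k B p =
    cong₂ (λ b n → if b then pow q n else 0#)
          (cong₂ _∧_ (nonAttacking-below p) (cong (_≡ᵇ k) (length-map below p)))
          (trans (count-map (countedCell (map below p)) below B) (count-cong B (countedCell-below p)))

  qRookBoard-below : ∀ k B → qRookBoard k (map below B) ≈ qRookBoard k B
  qRookBoard-below k B = begin
    ∑ (sublists (map below B)) (weight k (map below B))
      ≡⟨ cong (λ ps → ∑ ps (weight k (map below B))) (sublists-map below B) ⟩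
    ∑ (map (map below) (sublists B)) (weight k (map below B))
      ≡⟨ ∑-map (map below) (sublists B) (weight k (map below B)) ⟩
    ∑ (sublists B) (weight k (map below B) ∘ map below)
      ≈⟨ ∑-cong (sublists B) (λ p → ≈-reflexive (weight-below k B p)) ⟩
    qRookBoard k B ∎

  qRookBoard-vanish : ∀ {x k B} → All (InColumns x) B → x < k → qRookBoard k B ≈ 0#
  qRookBoard-vanish {x} {k} {B} B-in x<k =
    ≈-trans (∑-cong-All {g = λ _ → 0#} (sublists-All B-in) vanish) (∑-zero (sublists B) (λ _ → ≈-refl))
    where
    vanish : ∀ {t} → All (InColumns x) t → weight k B t ≈ 0#
    vanish {t} t-in with isPlacement k t in e
    ... | false = ≈-refl
    ... | true  with (na , len≡k) ← isPlacement⇒ k t e =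
      ⊥-elim (<⇒≱ x<k (subst (_≤ x) (trans (countUpTo-hasColumn t na t-in) len≡k) (countUpTo-≤ _ x)))

  weight-zero-∷ : ∀ B a t → weight 0 B (a ∷ t) ≈ 0#
  weight-zero-∷ B a t rewrite ∧-zeroʳ (nonAttacking (a ∷ t)) = ≈-refl

  if-∧-pow : ∀ a b m n → (if a ∧ b then pow q (m N.+ n) else 0#) ≈
                         (if a then pow q m else 0#) * (if b then pow q n else 0#)
  if-∧-pow true  true  m n = pow-+ m n
  if-∧-pow true  false m n = ≈-sym (zeroʳ _)
  if-∧-pow false b     m n = ≈-sym (zeroˡ _)

  module TopRow (i x : ℕ) {B : List Cell} (B-below : All (BelowRow i x) B) where

    private
      A : List Cell
      A = rowCells i x

      free : List Cell → ℕ → Bool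
      free t j = not (hasColumn (suc j) t)

      freeRightOf : List Cell → ℕ → ℕ
      freeRightOf t j = countUpTo (λ j′ → (j <ᵇ j′) ∧ free t j′) x

      rookFactor : List Cell → ℕ → Carrier
      rookFactor t j = if free t j then pow q (freeRightOf t j) else 0#

      placements-below : All (All (BelowRow i x)) (sublists B)
      placements-below = sublists-All B-below

      count-free : ∀ {t} → All (BelowRow i x) t → nonAttacking t ≡ true → countUpTo (free t) x ≡ x ∸ length t
      count-free {t} t-below na =
        trans (countUpTo-not _ x) (cong (x ∸_) (countUpTo-hasColumn t na (All.map proj₂ t-below)))

      count-row : ∀ {t} → All (BelowRow i x) t → nonAttacking t ≡ true → count (countedCell t) A ≡ x ∸ length t
      count-row {t} t-below na =
        trans (count-map (countedCell t) (λ j → (i , suc j)) (upTo x))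
              (trans (count-applyUpTo _ id x)
                     (trans (countUpTo-cong x (λ j → countedCell-inRow t-below (suc j))) (count-free t-below na)))

      count-row-rook : ∀ {t} → All (BelowRow i x) t → ∀ j →
        count (countedCell ((i , suc j) ∷ t)) (A ++ B) ≡ freeRightOf t j N.+ count (countedCell t) B
      count-row-rook {t} t-below j =
        trans (count-++ (countedCell ((i , suc j) ∷ t)) A B)
              (cong₂ N._+_ (trans (count-map _ (λ j′ → (i , suc j′)) (upTo x))
                             (trans (count-applyUpTo _ id x)
                                    (countUpTo-cong x (countedCell-inRow-rook t-below j))))
                           (count-cong-All _ _ B-below (countedCell-belowRow t (suc j))))

      weight-noRookInRow : ∀ k {t} → All (BelowRow i x) t → weight k (A ++ B) t ≈ pow q (x ∸ k) * weight k B t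
      weight-noRookInRow k {t} t-below with isPlacement k t in e
      ... | false = ≈-sym (zeroʳ _)
      ... | true  with (na , len≡k) ← isPlacement⇒ k t e =
        ≈-trans (≈-reflexive (cong (pow q) count≡)) (pow-+ (x ∸ k) _)
        where
        count≡ : count (countedCell t) (A ++ B) ≡ (x ∸ k) N.+ count (countedCell t) B
        count≡ = trans (count-++ (countedCell t) A B)
                       (cong (N._+ _) (trans (count-row t-below na) (cong (x ∸_) len≡k)))

      weight-rookInRow : ∀ k {t} → All (BelowRow i x) t → ∀ j →
        weight (suc k) (A ++ B) ((i , suc j) ∷ t) ≈
          rookFactor t j * weight k B t
      weight-rookInRow k {t} t-below j =
        ≈-trans (≈-reflexive (cong₂ (λ b n → if b then pow q n else 0#) placement≡ (count-row-rook t-below j)))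
                (if-∧-pow (free t j) (isPlacement k t) (freeRightOf t j) (count (countedCell t) B))
        where
        placement≡ : isPlacement (suc k) ((i , suc j) ∷ t) ≡ free t j ∧ isPlacement k t
        placement≡ = trans (cong (_∧ (length t ≡ᵇ k)) (nonAttacking-rowRook t-below (suc j)))
                           (∧-assoc (free t j) (nonAttacking t) (length t ≡ᵇ k))

      qint-free : ∀ k {t} → All (BelowRow i x) t →
                  qint q (countUpTo (free t) x) * weight k B t ≈ qint q (x ∸ k) * weight k B t
      qint-free k {t} t-below with isPlacement k t in e
      ... | false = ≈-trans (zeroʳ _) (≈-sym (zeroʳ _))
      ... | true  with (na , len≡k) ← isPlacement⇒ k t e =
        *-congʳ (≈-reflexive (cong (qint q) (trans (count-free t-below na) (cong (x ∸_) len≡k))))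

      ∑-rookInRow : ∀ k {t} → All (BelowRow i x) t →
                    ∑ A (λ a → weight (suc k) (A ++ B) (a ∷ t)) ≈ qint q (x ∸ k) * weight k B t
      ∑-rookInRow k {t} t-below = begin
        ∑ A (λ a → weight (suc k) (A ++ B) (a ∷ t))
          ≡⟨ trans (∑-map _ (upTo x) _) (∑-applyUpTo id x _) ⟩
        sumUpTo (λ j → weight (suc k) (A ++ B) ((i , suc j) ∷ t)) x
          ≈⟨ sumUpTo-cong x (weight-rookInRow k t-below) ⟩
        sumUpTo (λ j → rookFactor t j * weight k B t) x
          ≈⟨ sumUpTo-*ʳ (rookFactor t) (weight k B t) x ⟩
        sumUpTo (rookFactor t) x * weight k B t
          ≈⟨ *-congʳ (sumUpTo-pow-countAbove (free t) x) ⟩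
        qint q (countUpTo (free t) x) * weight k B t
          ≈⟨ qint-free k t-below ⟩
        qint q (x ∸ k) * weight k B t ∎

      weight-twoRooksInRow : ∀ k {a b} s → proj₁ a ≡ i → proj₁ b ≡ i →
                             weight k (A ++ B) (a ∷ b ∷ s) ≈ 0#
      weight-twoRooksInRow k {_ , a} {_ , b} s refl refl rewrite nonAttacking-sameRow i a b s = ≈-refl

      qRookBoard-split : ∀ k → qRookBoard k (A ++ B) ≈
        ∑ (sublists B) (weight k (A ++ B)) + ∑ A (λ a → ∑ (sublists B) (λ t → weight k (A ++ B) (a ∷ t)))
      qRookBoard-split k =
        ≈-trans (∑-sublists-++ A B (weight k (A ++ B)))
                (∑-sublists-atMostOne (All-rowCells i x) _
                   (λ s a∈A b∈A → ∑-zero (sublists B) (λ t → weight-twoRooksInRow k (s ++ t) a∈A b∈A)))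

      ∑-noRookInRow : ∀ k → ∑ (sublists B) (weight k (A ++ B)) ≈ pow q (x ∸ k) * qRookBoard k B
      ∑-noRookInRow k = ≈-trans (∑-cong-All placements-below (weight-noRookInRow k))
                                (∑-*ˡ (sublists B) (pow q (x ∸ k)) (weight k B))

    qRookBoard-topRow-zero : qRookBoard 0 (A ++ B) ≈ pow q x * qRookBoard 0 B
    qRookBoard-topRow-zero = begin
      qRookBoard 0 (A ++ B)
        ≈⟨ qRookBoard-split 0 ⟩
      ∑ (sublists B) (weight 0 (A ++ B)) + ∑ A (λ a → ∑ (sublists B) (λ t → weight 0 (A ++ B) (a ∷ t)))
        ≈⟨ +-cong (∑-noRookInRow 0) (∑-zero A (λ a → ∑-zero (sublists B) (weight-zero-∷ (A ++ B) a))) ⟩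
      pow q x * qRookBoard 0 B + 0#
        ≈⟨ +-identityʳ _ ⟩
      pow q x * qRookBoard 0 B ∎

    qRookBoard-topRow-suc : ∀ k → qRookBoard (suc k) (A ++ B) ≈
                            pow q (x ∸ suc k) * qRookBoard (suc k) B + qint q (x ∸ k) * qRookBoard k B
    qRookBoard-topRow-suc k = begin
      qRookBoard (suc k) (A ++ B)
        ≈⟨ qRookBoard-split (suc k) ⟩
      ∑ (sublists B) (weight (suc k) (A ++ B)) + ∑ A (λ a → ∑ (sublists B) (λ t → oneRook a t))
        ≈⟨ +-cong (∑-noRookInRow (suc k)) (∑-comm A (sublists B) oneRook) ⟩
      pow q (x ∸ suc k) * qRookBoard (suc k) B + ∑ (sublists B) (λ t → ∑ A (λ a → oneRook a t))
        ≈⟨ +-congˡ (∑-cong-All placements-below (∑-rookInRow k)) ⟩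
      pow q (x ∸ suc k) * qRookBoard (suc k) B + ∑ (sublists B) (λ t → qint q (x ∸ k) * weight k B t)
        ≈⟨ +-congˡ (∑-*ˡ (sublists B) (qint q (x ∸ k)) (weight k B)) ⟩
      pow q (x ∸ suc k) * qRookBoard (suc k) B + qint q (x ∸ k) * qRookBoard k B ∎
      where
      oneRook : Cell → List Cell → Carrier
      oneRook a t = weight (suc k) (A ++ B) (a ∷ t)

  open TopRow using (qRookBoard-topRow-zero; qRookBoard-topRow-suc)

  lowerRows-below : ∀ {x μ} → All (_≤ x) μ → All (BelowRow 1 x) (cellsFrom 2 μ)
  lowerRows-below μ≤x = All-BelowRow-cellsFrom 2 μ≤x (s≤s (s≤s z≤n))

  qRookBoard-lowerRows : ∀ k μ → qRookBoard k (cellsFrom 2 μ) ≈ qRook q k μ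
  qRookBoard-lowerRows k μ = ≈-trans (≈-reflexive (cong (qRookBoard k) (cellsFrom-suc 1 μ)))
                                     (≈-trans (qRookBoard-below k (cells μ)) (≈-sym (qRook≈qRookBoard k μ)))

  qRook-cons-zero : ∀ {x μ} → All (_≤ x) μ → qRook q 0 (x ∷ μ) ≈ pow q x * qRook q 0 μ
  qRook-cons-zero {x} {μ} μ≤x = begin
    qRook q 0 (x ∷ μ)
      ≈⟨ qRook≈qRookBoard 0 (x ∷ μ) ⟩
    qRookBoard 0 (rowCells 1 x ++ cellsFrom 2 μ)
      ≈⟨ qRookBoard-topRow-zero 1 x (lowerRows-below μ≤x) ⟩
    pow q x * qRookBoard 0 (cellsFrom 2 μ)
      ≈⟨ *-congˡ (qRookBoard-lowerRows 0 μ) ⟩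
    pow q x * qRook q 0 μ ∎

  qRook-cons-suc : ∀ {x μ} k → All (_≤ x) μ →
    qRook q (suc k) (x ∷ μ) ≈ pow q (x ∸ suc k) * qRook q (suc k) μ + qint q (x ∸ k) * qRook q k μ
  qRook-cons-suc {x} {μ} k μ≤x = begin
    qRook q (suc k) (x ∷ μ)
      ≈⟨ qRook≈qRookBoard (suc k) (x ∷ μ) ⟩
    qRookBoard (suc k) (rowCells 1 x ++ cellsFrom 2 μ)
      ≈⟨ qRookBoard-topRow-suc 1 x (lowerRows-below μ≤x) k ⟩
    pow q (x ∸ suc k) * qRookBoard (suc k) (cellsFrom 2 μ) + qint q (x ∸ k) * qRookBoard k (cellsFrom 2 μ)
      ≈⟨ +-cong (*-congˡ (qRookBoard-lowerRows (suc k) μ)) (*-congˡ (qRookBoard-lowerRows k μ)) ⟩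
    pow q (x ∸ suc k) * qRook q (suc k) μ + qint q (x ∸ k) * qRook q k μ ∎

  -- Truncated subtraction is harmless here: for k > x both sides vanish.
  pow-∸-absorb : ∀ {x μ} k → All (_≤ x) μ → pow q x * qRook q k μ ≈ (pow q (x ∸ k) * pow q k) * qRook q k μ
  pow-∸-absorb {x} {μ} k μ≤x with k ≤? x
  ... | yes k≤x = *-congʳ (≈-trans (≈-reflexive (cong (pow q) (sym (m∸n+n≡m k≤x)))) (pow-+ (x ∸ k) k))
  ... | no  k≰x = ≈-trans (*-congˡ vanish) (≈-trans (zeroʳ _) (≈-sym (≈-trans (*-congˡ vanish) (zeroʳ _))))
    where
    vanish : qRook q k μ ≈ 0#
    vanish = ≈-trans (qRook≈qRookBoard k μ)
                     (qRookBoard-vanish (All.map proj₂ (All-BelowRow-cellsFrom {0} 1 μ≤x (s≤s z≤n)))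
                                        (≰⇒> k≰x))

  -- The row-removal identity

  removalSum : ℕ → List ℕ → (List ℕ → Carrier) → Carrier
  removalSum n la F = sumFrom1 n (λ i → pow q ((i ∸ 1) N.+ part la i) * F (removeRow la i))

  removalSum-cong : ∀ n la {F G} → (∀ i → F (removeRow la i) ≈ G (removeRow la i)) →
                    removalSum n la F ≈ removalSum n la G
  removalSum-cong n la h = sumFrom1-cong n (λ i → *-congˡ (h (suc i)))

  removalSum-+ : ∀ n la F G → removalSum n la (λ ρ → F ρ + G ρ) ≈ removalSum n la F + removalSum n la G
  removalSum-+ n la F G = ≈-trans (sumFrom1-cong n (λ _ → distribˡ _ _ _)) (sumFrom1-+ n _ _)

  removalSum-*ˡ : ∀ n la a F → removalSum n la (λ ρ → a * F ρ) ≈ a * removalSum n la F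
  removalSum-*ˡ n la a F = ≈-trans (sumFrom1-cong n (λ _ → x*yz≈y*xz _ _ _)) (sumFrom1-*ˡ n a _)

  -- Row 1 of x ∷ μ gives the first term; removing row i+1 keeps row 1 and shifts the weight by q.
  removalSum-cons : ∀ n x μ F →
                    removalSum (suc n) (x ∷ μ) F ≈ pow q x * F μ + q * removalSum n μ (F ∘ (x ∷_))
  removalSum-cons n x μ F =
    ≈-trans (sumFrom1-shift n _) (+-congˡ (≈-trans (sumFrom1-cong n (λ _ → *-assoc _ _ _)) (sumFrom1-*ˡ n q _)))

  qint*qRook-[] : ∀ k → qint q k * qRook q k [] ≈ 0#
  qint*qRook-[] zero    = zeroˡ _
  qint*qRook-[] (suc k) = zeroʳ _

  -- The theorem with the subtracted term moved to the left, so that every step is a semiring identity.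
  removalSum-qRook : ∀ la n k → AllPairs _≥_ la → length la ≤ n →
                     removalSum n la (qRook q k) + qint q k * qRook q k la ≈ qint q n * qRook q k la
  removalSum-qRook [] n k _ _ =
    ≈-trans (+-cong emptyBoard (qint*qRook-[] k)) (+-identityʳ _)
    where
    emptyBoard : removalSum n [] (qRook q k) ≈ qint q n * qRook q k []
    emptyBoard = ≈-trans (sumFrom1-cong n (λ i → *-congʳ (≈-reflexive (cong (pow q) (ℕ-+-identityʳ i)))))
                         (sumFrom1-*ʳ n (qRook q k []) (λ i → pow q (i ∸ 1)))
  removalSum-qRook (x ∷ μ) (suc n) zero (μ≤x ∷ μ-sorted) (s≤s len≤n) = begin
    removalSum (suc n) (x ∷ μ) (qRook q 0) + 0# * qRook q 0 (x ∷ μ)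
      ≈⟨ +-cong (removalSum-cons n x μ (qRook q 0)) (*-congˡ (qRook-cons-zero μ≤x)) ⟩
    (X * R₀ + q * removalSum n μ (qRook q 0 ∘ (x ∷_))) + 0# * (X * R₀)
      ≈⟨ +-congʳ (+-congˡ (*-congˡ linearity)) ⟩
    (X * R₀ + q * (X * S₀)) + 0# * (X * R₀)
      ≈⟨ solve 4 (λ q X r s → (X :* r :+ q :* (X :* s)) :+ con 0 :* (X :* r)
                               := X :* r :+ (q :* X) :* (s :+ con 0 :* r)) ≈-refl q X R₀ S₀ ⟩
    X * R₀ + (q * X) * (S₀ + 0# * R₀)
      ≈⟨ +-congˡ (*-congˡ (removalSum-qRook μ n 0 μ-sorted len≤n)) ⟩
    X * R₀ + (q * X) * (qint q n * R₀)
      ≈⟨ solve 4 (λ q X r a → X :* r :+ (q :* X) :* (a :* r) := (con 1 :+ q :* a) :* (X :* r))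
                 ≈-refl q X R₀ (qint q n) ⟩
    (1# + q * qint q n) * (X * R₀)
      ≈⟨ *-cong (qint-suc n) (qRook-cons-zero μ≤x) ⟨
    qint q (suc n) * qRook q 0 (x ∷ μ) ∎
    where
    X R₀ S₀ : Carrier
    X  = pow q x
    R₀ = qRook q 0 μ
    S₀ = removalSum n μ (qRook q 0)
    linearity : removalSum n μ (qRook q 0 ∘ (x ∷_)) ≈ X * S₀
    linearity = ≈-trans (removalSum-cong n μ {qRook q 0 ∘ (x ∷_)} {λ ρ → X * qRook q 0 ρ}
                                         (λ i → qRook-cons-zero (All-removeRow μ≤x i)))
                        (removalSum-*ˡ n μ X (qRook q 0))
  removalSum-qRook (x ∷ μ) (suc n) (suc k) (μ≤x ∷ μ-sorted) (s≤s len≤n) = begin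
    removalSum (suc n) (x ∷ μ) (qRook q (suc k)) + qint q (suc k) * qRook q (suc k) (x ∷ μ)
      ≈⟨ +-cong (removalSum-cons n x μ (qRook q (suc k))) (*-cong (qint-suc k) (qRook-cons-suc k μ≤x)) ⟩
    (pow q x * Rₖ + q * removalSum n μ (qRook q (suc k) ∘ (x ∷_))) + (1# + q * qint q k) * (P * Rₖ + C * Rₖ₋₁)
      ≈⟨ +-congʳ (+-cong (pow-∸-absorb (suc k) μ≤x) (*-congˡ linearity)) ⟩
    ((P * (q * pow q k)) * Rₖ + q * (P * Sₖ + C * Sₖ₋₁)) + (1# + q * qint q k) * (P * Rₖ + C * Rₖ₋₁)
      ≈⟨ solve 9 (λ q b Q P C r r′ s s′ →
                    ((P :* (q :* Q)) :* r :+ q :* (P :* s :+ C :* s′)) :+ (con 1 :+ q :* b) :* (P :* r :+ C :* r′)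
                    := (P :* r :+ C :* r′) :+ ((q :* P) :* (s :+ (b :+ Q) :* r) :+ (q :* C) :* (s′ :+ b :* r′)))
                 ≈-refl q (qint q k) (pow q k) P C Rₖ Rₖ₋₁ Sₖ Sₖ₋₁ ⟩
    (P * Rₖ + C * Rₖ₋₁) + ((q * P) * (Sₖ + qint q (suc k) * Rₖ) + (q * C) * (Sₖ₋₁ + qint q k * Rₖ₋₁))
      ≈⟨ +-congˡ (+-cong (*-congˡ (removalSum-qRook μ n (suc k) μ-sorted len≤n))
                         (*-congˡ (removalSum-qRook μ n k μ-sorted len≤n))) ⟩
    (P * Rₖ + C * Rₖ₋₁) + ((q * P) * (qint q n * Rₖ) + (q * C) * (qint q n * Rₖ₋₁))
      ≈⟨ solve 6 (λ q a P C r r′ → (P :* r :+ C :* r′) :+ ((q :* P) :* (a :* r) :+ (q :* C) :* (a :* r′))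
                                    := (con 1 :+ q :* a) :* (P :* r :+ C :* r′))
                 ≈-refl q (qint q n) P C Rₖ Rₖ₋₁ ⟩
    (1# + q * qint q n) * (P * Rₖ + C * Rₖ₋₁)
      ≈⟨ *-cong (qint-suc n) (qRook-cons-suc k μ≤x) ⟨
    qint q (suc n) * qRook q (suc k) (x ∷ μ) ∎
    where
    P C Rₖ Rₖ₋₁ Sₖ Sₖ₋₁ : Carrier
    P    = pow q (x ∸ suc k)
    C    = qint q (x ∸ k)
    Rₖ   = qRook q (suc k) μ
    Rₖ₋₁ = qRook q k μ
    Sₖ   = removalSum n μ (qRook q (suc k))
    Sₖ₋₁ = removalSum n μ (qRook q k)
    linearity : removalSum n μ (qRook q (suc k) ∘ (x ∷_)) ≈ P * Sₖ + C * Sₖ₋₁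
    linearity = ≈-trans (removalSum-cong n μ {qRook q (suc k) ∘ (x ∷_)}
                                             {λ ρ → P * qRook q (suc k) ρ + C * qRook q k ρ}
                                             (λ i → qRook-cons-suc k (All-removeRow μ≤x i)))
                        (≈-trans (removalSum-+ n μ (λ ρ → P * qRook q (suc k) ρ) (λ ρ → C * qRook q k ρ))
                                 (+-cong (removalSum-*ˡ n μ P (qRook q (suc k))) (removalSum-*ˡ n μ C (qRook q k))))

lemma3p4 : ∀ {c ℓ : Level} (R : CommutativeRing c ℓ) (q : CommutativeRing.Carrier R)
           (la : List ℕ) (n k : ℕ) → IsPartition la → length la ≤ n →
           let open CommutativeRing R
               open QRook R
           in sumFrom1 n (λ i → pow q ((i ∸ 1) N.+ part la i) * qRook q k (removeRow la i))
                ≈ qint q n * qRook q k la - qint q k * qRook q k la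
lemma3p4 R q la n k (la-decreasing , _) len≤n =
  x≈z//y _ _ _ (removalSum-qRook la n k (Linked⇒AllPairs (flip ≤-trans) la-decreasing) len≤n)
  where
  open RookSums R q using (removalSum-qRook)
  open GroupProperties (CommutativeRing.+-group R) using (x≈z//y)
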